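{- For all odd integers $m,n$ with $m\in\{7,9,11\}$ and $n\geq m$, $\chi_{lid}(C_m\square C_n)=4$.
   Context: $C_n$ denotes the cycle on $n$ vertices. A proper $k$-coloring of a graph $G$ is a map $f:V(G)\to\{1,\dots,k\}$ with $f(u)\neq f(v)$ for every edge $uv$. For a vertex $v$, $N[v]$ denotes its closed neighborhood, and $f(S)=\{f(x):x\in S\}$. A lid-coloring of $G$ is a proper coloring $f$ such that for every edge $uv$ with $N[u]\neq N[v]$ we have $f(N[u])\neq f(N[v])$; $\chi_{lid}(G)$ is the smallest number of colors in a lid-coloring of $G$. The Cartesian product $G\square H$ has vertex set $V(G)\times V(H)$, where $(u_1,v_1)$ and $(u_2,v_2)$ are adjacent iff either $u_1=u_2$ and $v_1v_2\in E(H)$, or $v_1=v_2$ and $u_1u_2\in E(G)$. -}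

module Defs where

open import Data.Nat using (ℕ; zero; suc; _+_; _*_; _<_)
open import Data.Fin using (Fin; toℕ)
open import Data.Product using (Σ; ∃; _×_; _,_)
open import Data.Sum using (_⊎_)
open import Relation.Binary.PropositionalEquality using (_≡_; _≢_)
open import Relation.Nullary using (¬_)
open import Function.Bundles using (_⇔_)

record Graph : Set₁ where
  field
    V   : Set
    Adj : V → V → Set
open Graph public

Odd : ℕ → Set
Odd n = ∃ λ k → n ≡ suc (2 * k)

CycSucc : (n : ℕ) → Fin n → Fin n → Set
CycSucc n i j = (toℕ j ≡ suc (toℕ i)) ⊎ ((suc (toℕ i) ≡ n) × (toℕ j ≡ 0))

Cycle : ℕ → Graph
Cycle n = record
  { V   = Fin n
  ; Adj = λ i j → CycSucc n i j ⊎ CycSucc n j i }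

_□_ : Graph → Graph → Graph
G □ H = record
  { V   = V G × V H
  ; Adj = λ { (u₁ , v₁) (u₂ , v₂) →
              ((u₁ ≡ u₂) × Adj H v₁ v₂) ⊎ ((v₁ ≡ v₂) × Adj G u₁ u₂) } }

InN : (G : Graph) → V G → V G → Set
InN G v x = (x ≡ v) ⊎ Adj G v x

InColN : (G : Graph) {k : ℕ} → (V G → Fin k) → V G → Fin k → Set
InColN G f v c = Σ (V G) λ x → InN G v x × (f x ≡ c)

Proper : (G : Graph) {k : ℕ} → (V G → Fin k) → Set
Proper G f = ∀ u v → Adj G u v → f u ≢ f v

IsLid : (G : Graph) {k : ℕ} → (V G → Fin k) → Set
IsLid G {k} f =
  Proper G f ×
  (∀ u v → Adj G u v →
     ¬ (∀ x → InN G u x ⇔ InN G v x) →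
     ¬ (∀ (c : Fin k) → InColN G f u c ⇔ InColN G f v c))

LidColourable : Graph → ℕ → Set
LidColourable G k = Σ (V G → Fin k) λ f → IsLid G f

χlid≡ : Graph → ℕ → Set
χlid≡ G k = LidColourable G k × (∀ j → j < k → ¬ LidColourable G j)

module Submission where

-- Lower bound: in a proper 3-colouring of the 4-regular torus, a vertex whose four neighbours share a
-- colour c sees exactly {f u, c}, and any other vertex sees all three colours. Two adjacent vertices of
-- the same kind therefore see the same colours, so in a lid-colouring the two kinds alternate along
-- each row of C_m □ C_n, which is impossible since m is odd.
-- Upper bound: for n = 2k + 7, colour column j by one of five fixed colourings of C_m, following the
-- cyclic pattern (0 1)^(k+2) 2 3 4. Whether an edge is separated depends only on its row and on the
-- types of the four columns around it; only eight such windows occur, so for m = 7, 9, 11 it suffices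
-- to check an explicit table of five colourings by computation.

open import Defs
open import Data.Nat using (ℕ; _≤_)
open import Data.Sum using (_⊎_)
open import Relation.Binary.PropositionalEquality using (_≡_)

open import Data.Bool using (Bool; not)
open import Data.Bool.Properties using (not-¬; not-involutive)
open import Data.Empty using (⊥-elim)
open import Data.Fin using (Fin; zero; suc; toℕ; fromℕ; fromℕ<; inject₁; inject≤; #_)
open import Data.Fin.Properties
  using (toℕ<n; toℕ-fromℕ; toℕ-fromℕ<; toℕ-inject₁; toℕ-injective; inject≤-injective; _≟_; all?; ¬∀⟶∃¬)
open import Data.List using (List; []; _∷_)
open import Data.List.Membership.Propositional using () renaming (_∈_ to _∈ₗ_)
import Data.List.Relation.Unary.All as ListAll
import Data.List.Relation.Unary.Any as ListAny
open import Data.Nat using (zero; suc; _+_; _*_; _<_; _<?_; s≤s; z<s; s<s; s<s⁻¹; s≤s⁻¹)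
open import Data.Nat.GeneralisedArithmetic using (fold)
open import Data.Nat.Properties
  using (+-identityʳ; +-suc; *-suc; *-distribˡ-+; ≤-antisym; ≮⇒≥; <-irrefl; <-trans; ≤-trans; n<1+n; m≤n+m; 1+n≢n; suc-injective)
open import Data.Product using (∃; _×_; _,_; proj₁; proj₂; uncurry)
open import Data.Product.Properties using (≡-dec)
open import Data.Sum using (inj₁; inj₂; swap)
open import Data.Vec using (Vec; []; _∷_; map; head; lookup)
open import Data.Vec.Membership.Propositional using (_∈_; find)
open import Data.Vec.Membership.Propositional.Properties using (∈-map⁺; ∈-lookup)
import Data.Vec.Relation.Unary.All as All
import Data.Vec.Relation.Unary.All.Properties as All
open import Data.Vec.Relation.Unary.Any using (here; there; any?)
import Data.Vec.Relation.Unary.Any.Properties as Any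
open import Function.Base using (_∘_)
open import Function.Bundles using (_⇔_; mk⇔; Equivalence)
open import Function.Properties.Equivalence using () renaming (sym to ⇔-sym; trans to ⇔-trans)
open import Relation.Binary.PropositionalEquality using (_≢_; refl; sym; trans; cong; subst; module ≡-Reasoning)
open import Relation.Nullary using (¬_; Dec; yes; no; does)
open import Relation.Nullary.Decidable using (True; toWitness; ¬?; _×-dec_; _⊎-dec_; _→-dec_)
import Relation.Nullary.Decidable as Dec

private
  variable
    m n k : ℕ

-- Cycles

CycStep : ℕ → ℕ → ℕ → Set
CycStep n y z = (z ≡ suc y) ⊎ (suc y ≡ n × z ≡ 0)

next : Fin n → Fin n
next {suc n} i with suc (toℕ i) <? suc n
... | yes i+1<n = fromℕ< i+1<n
... | no _      = zero

prev : Fin n → Fin n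
prev {suc n} zero    = fromℕ n
prev {suc n} (suc i) = inject₁ i

CycSucc-next : (i : Fin n) → CycSucc n i (next i)
CycSucc-next {suc n} i with suc (toℕ i) <? suc n
... | yes i+1<n = inj₁ (toℕ-fromℕ< i+1<n)
... | no  i+1≮n = inj₂ (≤-antisym (toℕ<n i) (≮⇒≥ i+1≮n) , refl)

CycSucc-prev : (i : Fin n) → CycSucc n (prev i) i
CycSucc-prev {suc n} zero    = inj₂ (cong suc (toℕ-fromℕ n) , refl)
CycSucc-prev {suc n} (suc i) = inj₁ (cong suc (sym (toℕ-inject₁ i)))

CycStep-functional : ∀ {y z z′} → z < n → z′ < n → CycStep n y z → CycStep n y z′ → z ≡ z′
CycStep-functional _   _    (inj₁ refl)       (inj₁ refl)       = refl
CycStep-functional z<n _    (inj₁ refl)       (inj₂ (refl , _)) = ⊥-elim (<-irrefl refl z<n)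
CycStep-functional _   z′<n (inj₂ (refl , _)) (inj₁ refl)       = ⊥-elim (<-irrefl refl z′<n)
CycStep-functional _   _    (inj₂ (_ , refl)) (inj₂ (_ , refl)) = refl

CycStep-injective : ∀ {y y′ z} → CycStep n y z → CycStep n y′ z → y ≡ y′
CycStep-injective (inj₁ refl)       (inj₁ refl)       = refl
CycStep-injective (inj₁ refl)       (inj₂ (_ , ()))
CycStep-injective (inj₂ (_ , refl)) (inj₁ ())
CycStep-injective (inj₂ (y+1≡n , _)) (inj₂ (y′+1≡n , _)) = suc-injective (trans y+1≡n (sym y′+1≡n))

next-unique : {i j : Fin n} → CycSucc n i j → j ≡ next i
next-unique {i = i} {j} s = toℕ-injective (CycStep-functional (toℕ<n j) (toℕ<n (next i)) s (CycSucc-next i))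

prev-unique : {i j : Fin n} → CycSucc n i j → i ≡ prev j
prev-unique {j = j} s = toℕ-injective (CycStep-injective s (CycSucc-prev j))

prev-next : (i : Fin n) → prev (next i) ≡ i
prev-next i = sym (prev-unique (CycSucc-next i))

next-≢ : 1 < n → (i : Fin n) → next i ≢ i
next-≢ 1<n i next-i≡i with CycSucc-next i | cong toℕ next-i≡i
... | inj₁ i+1≡next-i          | next-i≡i′ = 1+n≢n (trans (sym i+1≡next-i) next-i≡i′)
... | inj₂ (i+1≡n , next-i≡0) | next-i≡i′ =
  <-irrefl (trans (cong suc (sym (trans (sym next-i≡i′) next-i≡0))) i+1≡n) 1<n

toℕ-next-< : (i : Fin n) → suc (toℕ i) < n → toℕ (next i) ≡ suc (toℕ i)
toℕ-next-< i i+1<n = CycStep-functional (toℕ<n (next i)) i+1<n (CycSucc-next i) (inj₁ refl)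

toℕ-next-last : (i : Fin (suc n)) → suc (toℕ i) ≡ suc n → toℕ (next i) ≡ 0
toℕ-next-last i i+1≡n = CycStep-functional (toℕ<n (next i)) z<s (CycSucc-next i) (inj₂ (i+1≡n , refl))

walk : ℕ → Fin (suc n)
walk = fold zero next

toℕ-walk : ∀ x → x < suc n → toℕ (walk {n} x) ≡ x
toℕ-walk zero    _     = refl
toℕ-walk {n} (suc x) x+1<n =
  trans (toℕ-next-< (walk x) (subst (λ y → suc y < suc n) (sym ih) x+1<n)) (cong suc ih)
  where ih = toℕ-walk x (<-trans (n<1+n x) x+1<n)

walk-around : walk {n} (suc n) ≡ zero
walk-around {n} = toℕ-injective (toℕ-next-last (walk n) (cong suc (toℕ-walk n (n<1+n n))))

fold-not-even : ∀ q b → fold b not (2 * q) ≡ b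
fold-not-even zero    b = refl
fold-not-even (suc q) b =
  trans (cong (fold b not) (*-suc 2 q)) (trans (not-involutive _) (fold-not-even q b))

no-alternation-on-odd-cycle : Odd n → (β : Fin n → Bool) → ¬ (∀ i → β (next i) ≡ not (β i))
no-alternation-on-odd-cycle (q , refl) β alternates = not-¬ refl β₀≡¬β₀
  where
  β-walk : ∀ x → β (walk x) ≡ fold (β zero) not x
  β-walk zero    = refl
  β-walk (suc x) = trans (alternates (walk x)) (cong not (β-walk x))
  open ≡-Reasoning
  β₀≡¬β₀ : β zero ≡ not (β zero)
  β₀≡¬β₀ = begin
    β zero                              ≡⟨ cong β (sym walk-around) ⟩
    β (walk (suc (2 * q)))              ≡⟨ β-walk (suc (2 * q)) ⟩
    not (fold (β zero) not (2 * q))     ≡⟨ cong not (fold-not-even q (β zero)) ⟩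
    not (β zero)                        ∎

-- Closed neighbourhoods in the torus

Torus : ℕ → ℕ → Graph
Torus m n = Cycle m □ Cycle n

nbrs : Fin m × Fin n → Vec (Fin m × Fin n) 4
nbrs (i , j) = (next i , j) ∷ (prev i , j) ∷ (i , next j) ∷ (i , prev j) ∷ []

Adj⇒∈nbrs : ∀ {u v} → Adj (Torus m n) u v → v ∈ nbrs u
Adj⇒∈nbrs (inj₂ (refl , inj₁ s)) = here (cong (_, _) (next-unique s))
Adj⇒∈nbrs (inj₂ (refl , inj₂ s)) = there (here (cong (_, _) (prev-unique s)))
Adj⇒∈nbrs (inj₁ (refl , inj₁ s)) = there (there (here (cong (_ ,_) (next-unique s))))
Adj⇒∈nbrs (inj₁ (refl , inj₂ s)) = there (there (there (here (cong (_ ,_) (prev-unique s)))))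

∈nbrs⇒Adj : ∀ {u v} → v ∈ nbrs u → Adj (Torus m n) u v
∈nbrs⇒Adj {u = i , j} (here refl)                         = inj₂ (refl , inj₁ (CycSucc-next i))
∈nbrs⇒Adj {u = i , j} (there (here refl))                 = inj₂ (refl , inj₂ (CycSucc-prev i))
∈nbrs⇒Adj {u = i , j} (there (there (here refl)))         = inj₁ (refl , inj₁ (CycSucc-next j))
∈nbrs⇒Adj {u = i , j} (there (there (there (here refl)))) = inj₁ (refl , inj₂ (CycSucc-prev j))

Adj-sym : ∀ {u v} → Adj (Torus m n) u v → Adj (Torus m n) v u
Adj-sym (inj₁ (refl , s)) = inj₁ (refl , swap s)
Adj-sym (inj₂ (refl , s)) = inj₂ (refl , swap s)

InN⇔∈ : ∀ {u v} → InN (Torus m n) u v ⇔ v ∈ u ∷ nbrs u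
InN⇔∈ = mk⇔ to from
  where
  to : ∀ {u v} → InN (Torus _ _) u v → v ∈ u ∷ nbrs u
  to (inj₁ v≡u) = here v≡u
  to (inj₂ uv)  = there (Adj⇒∈nbrs uv)
  from : ∀ {u v} → v ∈ u ∷ nbrs u → InN (Torus _ _) u v
  from (here v≡u) = inj₁ v≡u
  from (there v∈) = inj₂ (∈nbrs⇒Adj v∈)

colours : (Fin m × Fin n → Fin k) → Fin m × Fin n → Vec (Fin k) 5
colours f u = map f (u ∷ nbrs u)

InColN⇔∈colours : ∀ (f : Fin m × Fin n → Fin k) {u c} → InColN (Torus m n) f u c ⇔ c ∈ colours f u
InColN⇔∈colours f {u} {c} = mk⇔ to from
  where
  to : InColN (Torus _ _) f u c → c ∈ colours f u
  to (v , v∈N , refl) = ∈-map⁺ f (Equivalence.to InN⇔∈ v∈N)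
  from : c ∈ colours f u → InColN (Torus _ _) f u c
  from c∈ with find (Any.map⁻ {f = f} c∈)
  ... | v , v∈ , c≡fv = v , Equivalence.from InN⇔∈ v∈ , sym c≡fv

SameColours : ∀ {a b} → Vec (Fin k) a → Vec (Fin k) b → Set
SameColours xs ys = ∀ c → c ∈ xs ⇔ c ∈ ys

sameInColN⇔SameColours : ∀ (f : Fin m × Fin n → Fin k) {u v} →
  (∀ c → InColN (Torus m n) f u c ⇔ InColN (Torus m n) f v c) ⇔ SameColours (colours f u) (colours f v)
sameInColN⇔SameColours f = mk⇔
  (λ same c → ⇔-trans (⇔-sym (InColN⇔∈colours f)) (⇔-trans (same c) (InColN⇔∈colours f)))
  (λ same c → ⇔-trans (InColN⇔∈colours f) (⇔-trans (same c) (⇔-sym (InColN⇔∈colours f))))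

_⇔?_ : ∀ {A B : Set} → Dec A → Dec B → Dec (A ⇔ B)
a? ⇔? b? = Dec.map′ (uncurry mk⇔) (λ e → Equivalence.to e , Equivalence.from e)
                    ((a? →-dec b?) ×-dec (b? →-dec a?))

sameColours? : ∀ {a b} (xs : Vec (Fin k) a) (ys : Vec (Fin k) b) → Dec (SameColours xs ys)
sameColours? xs ys = all? λ c → any? (c ≟_) xs ⇔? any? (c ≟_) ys

-- No lid-colouring with three colours

LidColourable-mono : ∀ (G : Graph) {j k} → j ≤ k → LidColourable G j → LidColourable G k
LidColourable-mono G {j} {k} j≤k (f , proper , lid) = g , proper′ , lid′
  where
  g : V G → Fin k
  g v = inject≤ (f v) j≤k
  injective : ∀ c d → inject≤ c j≤k ≡ inject≤ d j≤k → c ≡ d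
  injective = inject≤-injective j≤k j≤k
  proper′ : Proper G g
  proper′ u v uv gu≡gv = proper u v uv (injective _ _ gu≡gv)
  reflect : ∀ {w c} → InColN G g w (inject≤ c j≤k) → InColN G f w c
  reflect (x , x∈N , gx≡c) = x , x∈N , injective _ _ gx≡c
  lid′ : ∀ u v → Adj G u v → ¬ (∀ x → InN G u x ⇔ InN G v x) →
         ¬ (∀ c → InColN G g u c ⇔ InColN G g v c)
  lid′ u v uv differ same = lid u v uv differ λ c → mk⇔
    (λ { (x , x∈N , refl) → reflect (Equivalence.to (same (g x)) (x , x∈N , refl)) })
    (λ { (x , x∈N , refl) → reflect (Equivalence.from (same (g x)) (x , x∈N , refl)) })

fin3-exhaust : ∀ (a b c d : Fin 3) → a ≢ b → a ≢ c → b ≢ c → d ≡ a ⊎ d ≡ b ⊎ d ≡ c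
fin3-exhaust = toWitness {a? = all? λ a → all? λ b → all? λ c → all? λ d →
  ¬? (a ≟ b) →-dec ¬? (a ≟ c) →-dec ¬? (b ≟ c) →-dec (d ≟ a ⊎-dec d ≟ b ⊎-dec d ≟ c)} _

module ThreeColouring (f : Fin m × Fin n → Fin 3) (proper : Proper (Torus m n) f) where

  MonochromeNbrs : Fin m × Fin n → Set
  MonochromeNbrs u = All.All (λ v → f v ≡ f (head (nbrs u))) (nbrs u)

  monochromeNbrs? : ∀ u → Dec (MonochromeNbrs u)
  monochromeNbrs? u = All.all? (λ v → f v ≟ f (head (nbrs u))) (nbrs u)

  monochrome⇒colours-⊆ : ∀ {u v c} → MonochromeNbrs u → Adj (Torus m n) u v →
                          c ∈ colours f u → c ∈ colours f v
  monochrome⇒colours-⊆ mono uv (here refl) = there (∈-map⁺ f (Adj⇒∈nbrs (Adj-sym uv)))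
  monochrome⇒colours-⊆ mono uv (there c∈) with find (Any.map⁻ {f = f} c∈)
  ... | x , x∈ , refl = here (trans (All.lookup mono x∈) (sym (All.lookup mono (Adj⇒∈nbrs uv))))

  ¬monochrome⇒bichrome : ∀ {u} → ¬ MonochromeNbrs u →
                          ∃ λ x → ∃ λ y → x ∈ nbrs u × y ∈ nbrs u × f x ≢ f y
  ¬monochrome⇒bichrome {u} ¬mono
    with ¬∀⟶∃¬ 4 _ (λ k → f (lookup (nbrs u) k) ≟ f (head (nbrs u))) (¬mono ∘ All.lookup⁻)
  ... | k , fx≢fx₀ = head (nbrs u) , lookup (nbrs u) k , here refl , ∈-lookup k (nbrs u) , fx≢fx₀ ∘ sym

  ¬monochrome⇒colours-full : ∀ {u} → ¬ MonochromeNbrs u → ∀ c → c ∈ colours f u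
  ¬monochrome⇒colours-full {u} ¬mono c with ¬monochrome⇒bichrome ¬mono
  ... | x , y , x∈ , y∈ , fx≢fy
      with fin3-exhaust (f u) (f x) (f y) c (proper u x (∈nbrs⇒Adj x∈)) (proper u y (∈nbrs⇒Adj y∈)) fx≢fy
  ...   | inj₁ refl        = here refl
  ...   | inj₂ (inj₁ refl) = there (∈-map⁺ f x∈)
  ...   | inj₂ (inj₂ refl) = there (∈-map⁺ f y∈)

  monochrome-alternates : IsLid (Torus m n) f → ∀ {u v} → Adj (Torus m n) u v →
                          ¬ (∀ x → InN (Torus m n) u x ⇔ InN (Torus m n) v x) →
                          (mono-u? : Dec (MonochromeNbrs u)) (mono-v? : Dec (MonochromeNbrs v)) →
                          does mono-v? ≡ not (does mono-u?)
  monochrome-alternates (_ , lid) {u} {v} uv differ = alternates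
    where
    distinct : ¬ SameColours (colours f u) (colours f v)
    distinct = lid u v uv differ ∘ Equivalence.from (sameInColN⇔SameColours f)
    alternates : (mono-u? : Dec (MonochromeNbrs u)) (mono-v? : Dec (MonochromeNbrs v)) →
                 does mono-v? ≡ not (does mono-u?)
    alternates (yes mono-u) (yes mono-v) = ⊥-elim (distinct λ c →
      mk⇔ (monochrome⇒colours-⊆ mono-u uv) (monochrome⇒colours-⊆ mono-v (Adj-sym uv)))
    alternates (yes _)      (no _)       = refl
    alternates (no _)       (yes _)      = refl
    alternates (no ¬mono-u) (no ¬mono-v) = ⊥-elim (distinct λ c →
      mk⇔ (λ _ → ¬monochrome⇒colours-full ¬mono-v c) (λ _ → ¬monochrome⇒colours-full ¬mono-u c))

row-nbhds-differ : 1 < m → 1 < n → ∀ i j →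
  ¬ (∀ x → InN (Torus m n) (i , j) x ⇔ InN (Torus m n) (next i , j) x)
row-nbhds-differ 1<m 1<n i j same
  with Equivalence.to (same (i , next j)) (inj₂ (inj₁ (refl , inj₁ (CycSucc-next j))))
... | inj₁ e                = next-≢ 1<n j (cong proj₂ e)
... | inj₂ (inj₁ (e , _))   = next-≢ 1<m i e
... | inj₂ (inj₂ (e , _))   = next-≢ 1<n j (sym e)

no-lid-3-colouring : Odd m → 1 < m → 1 < n → ¬ LidColourable (Torus m n) 3
no-lid-3-colouring {n = suc _} odd 1<m 1<n (f , lid@(proper , _)) =
  no-alternation-on-odd-cycle odd (λ i → does (monochromeNbrs? (i , zero))) λ i →
    monochrome-alternates lid (inj₂ (refl , inj₁ (CycSucc-next i))) (row-nbhds-differ 1<m 1<n i zero)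
      (monochromeNbrs? (i , zero)) (monochromeNbrs? (next i , zero))
  where open ThreeColouring f proper

-- Lid-colourings with four colours

torus-edge-elim : ∀ (R : Fin m × Fin n → Fin m × Fin n → Set) → (∀ {u v} → R u v → R v u) →
                  (∀ i j → R (i , j) (next i , j)) → (∀ i j → R (i , j) (i , next j)) →
                  ∀ {u v} → Adj (Torus m n) u v → R u v
torus-edge-elim R R-sym vertical horizontal {i , j} = λ where
  (inj₁ (refl , inj₁ s)) → subst (λ j′ → R (i , j) (i , j′)) (sym (next-unique s)) (horizontal i j)
  (inj₁ (refl , inj₂ s)) → R-sym (subst (λ j′ → R _ (i , j′)) (sym (next-unique s)) (horizontal i _))
  (inj₂ (refl , inj₁ s)) → subst (λ i′ → R (i , j) (i′ , j)) (sym (next-unique s)) (vertical i j)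
  (inj₂ (refl , inj₂ s)) → R-sym (subst (λ i′ → R _ (i′ , j)) (sym (next-unique s)) (vertical _ j))

Separated : (Fin m × Fin n → Fin k) → Fin m × Fin n → Fin m × Fin n → Set
Separated f u v = f u ≢ f v × ¬ SameColours (colours f u) (colours f v)

separated-sym : ∀ {f : Fin m × Fin n → Fin k} {u v} → Separated f u v → Separated f v u
separated-sym (fu≢fv , distinct) = fu≢fv ∘ sym , λ same → distinct λ c → ⇔-sym (same c)

separated⇒isLid : ∀ (f : Fin m × Fin n → Fin k) → (∀ {u v} → Adj (Torus m n) u v → Separated f u v) →
                  IsLid (Torus m n) f
separated⇒isLid f sep =
  (λ u v uv → proj₁ (sep uv)) ,
  (λ u v uv _ → proj₂ (sep uv) ∘ Equivalence.to (sameInColN⇔SameColours f))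

double : ℕ → ℕ
double zero    = zero
double (suc k) = suc (suc (double k))

-- Column types (0 1)ᵏ 2 3 4; positions beyond 2k + 2 get the junk type 4.
stripes : ℕ → ℕ → Fin 5
stripes zero    zero                = # 2
stripes zero    (suc zero)          = # 3
stripes zero    (suc (suc _))       = # 4
stripes (suc k) zero                = # 0
stripes (suc k) (suc zero)          = # 1
stripes (suc k) (suc (suc y))       = stripes k y

stripes-end : ∀ k r → stripes k (r + double k) ≡ stripes zero r
stripes-end zero    r = cong (stripes zero) (+-identityʳ r)
stripes-end (suc k) r =
  trans (cong (stripes (suc k)) (trans (+-suc r _) (cong suc (+-suc r _)))) (stripes-end k r)

Window : Set
Window = Fin 5 × Fin 5 × Fin 5 × Fin 5

-- The types of four consecutive columns under `stripes k`, read cyclically modulo 2k + 3, for k ≥ 2.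
windows : List Window
windows = (# 1 , # 0 , # 1 , # 0) ∷ (# 0 , # 1 , # 0 , # 1) ∷ (# 1 , # 0 , # 1 , # 2) ∷ (# 0 , # 1 , # 2 , # 3)
        ∷ (# 1 , # 2 , # 3 , # 4) ∷ (# 2 , # 3 , # 4 , # 0) ∷ (# 3 , # 4 , # 0 , # 1) ∷ (# 4 , # 0 , # 1 , # 0) ∷ []

admissible : ∀ w → {True (ListAny.any? (≡-dec _≟_ (≡-dec _≟_ (≡-dec _≟_ _≟_)) w) windows)} →
             w ∈ₗ windows
admissible w {w∈} = toWitness w∈

windowAt : (ℕ → Fin 5) → ℕ → ℕ → ℕ → ℕ → Window
windowAt s y a b c = s y , s a , s b , s c

stripes-inner : ∀ k y → y < double k → windowAt (stripes k) y (1 + y) (2 + y) (3 + y) ∈ₗ windows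
stripes-inner (suc zero)          zero          _ = admissible _
stripes-inner (suc zero)          (suc zero)    _ = admissible _
stripes-inner (suc (suc k))       zero          _ = admissible _
stripes-inner (suc (suc zero))    (suc zero)    _ = admissible _
stripes-inner (suc (suc (suc k))) (suc zero)    _ = admissible _
stripes-inner (suc k)             (suc (suc y)) y+2<2k+2 = stripes-inner k y (s<s⁻¹ (s<s⁻¹ y+2<2k+2))

-- The possible values under `toℕ` of four consecutive vertices of C_(3+x).
data Run (x : ℕ) : ℕ → ℕ → ℕ → ℕ → Set where
  inner : ∀ {y} → y < x → Run x y (1 + y) (2 + y) (3 + y)
  wrap₁ : Run x x (1 + x) (2 + x) 0
  wrap₂ : Run x (1 + x) (2 + x) 0 1
  wrap₃ : Run x (2 + x) 0 1 2

run-from-steps : ∀ {x y a b c} → CycStep (3 + x) y a → CycStep (3 + x) a b → CycStep (3 + x) b c →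
                 c < 3 + x → Run x y a b c
run-from-steps (inj₁ refl)         (inj₁ refl)         (inj₁ refl)         c<n = inner (s<s⁻¹ (s<s⁻¹ (s<s⁻¹ c<n)))
run-from-steps (inj₁ refl)         (inj₁ refl)         (inj₂ (refl , refl)) _  = wrap₁
run-from-steps (inj₁ refl)         (inj₂ (refl , refl)) (inj₁ refl)         _  = wrap₂
run-from-steps (inj₂ (refl , refl)) (inj₁ refl)         (inj₁ refl)         _  = wrap₃
run-from-steps (inj₁ refl)         (inj₂ (refl , refl)) (inj₂ (() , _))     _
run-from-steps (inj₂ (refl , refl)) (inj₁ refl)         (inj₂ (() , _))     _
run-from-steps (inj₂ (refl , refl)) (inj₂ (() , _))     _                   _

run : ∀ {x} (j : Fin (3 + x)) → Run x (toℕ (prev j)) (toℕ j) (toℕ (next j)) (toℕ (next (next j)))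
run j = run-from-steps (CycSucc-prev j) (CycSucc-next j) (CycSucc-next (next j)) (toℕ<n (next (next j)))

stripes-window : ∀ k {y a b c} → Run (double (2 + k)) y a b c → windowAt (stripes (2 + k)) y a b c ∈ₗ windows
stripes-window k (inner y<x) = stripes-inner (2 + k) _ y<x
stripes-window k wrap₁ rewrite stripes-end (2 + k) 0 | stripes-end (2 + k) 1 | stripes-end (2 + k) 2 = admissible _
stripes-window k wrap₂ rewrite stripes-end (2 + k) 1 | stripes-end (2 + k) 2 = admissible _
stripes-window k wrap₃ rewrite stripes-end (2 + k) 2 = admissible _

module StripeColouring (T : Fin 5 → Fin m → Fin k) where

  -- The colours of N[(i , j)] in the order of `nbrs`, when columns j-1, j, j+1 have types p, a, b.
  localColours : Fin m → Fin 5 → Fin 5 → Fin 5 → Vec (Fin k) 5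
  localColours i p a b = T a i ∷ T a (next i) ∷ T a (prev i) ∷ T b i ∷ T p i ∷ []

  -- The edges (i , j)–(i+1 , j) and (i , j)–(i , j+1) are separated when columns j-1, …, j+2 have
  -- types p, a, b, c.
  Compatible : Fin m → Window → Set
  Compatible i (p , a , b , c) =
    T a i ≢ T a (next i) × T a i ≢ T b i ×
    ¬ SameColours (localColours i p a b) (localColours (next i) p a b) ×
    ¬ SameColours (localColours i p a b) (localColours i a b c)

  compatible? : ∀ i w → Dec (Compatible i w)
  compatible? i (p , a , b , c) =
    ¬? (T a i ≟ T a (next i)) ×-dec ¬? (T a i ≟ T b i) ×-dec
    ¬? (sameColours? _ _) ×-dec ¬? (sameColours? _ _)

  Valid : Set
  Valid = ListAll.All (λ w → ∀ i → Compatible i w) windows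

  valid? : Dec Valid
  valid? = ListAll.all? (λ w → all? λ i → compatible? i w) windows

  module _ (valid : Valid) (k′ : ℕ) where

    column : Fin (3 + double (2 + k′)) → Fin 5
    column j = stripes (2 + k′) (toℕ j)

    colouring : Fin m × Fin (3 + double (2 + k′)) → Fin k
    colouring (i , j) = T (column j) i

    compatible-at : ∀ i j → Compatible i (column (prev j) , column j , column (next j) , column (next (next j)))
    compatible-at i j = ListAll.lookup valid (stripes-window k′ (run j)) i

    separated : ∀ {u v} → Adj (Torus m (3 + double (2 + k′))) u v → Separated colouring u v
    separated = torus-edge-elim (Separated colouring) (λ {u v} → separated-sym {f = colouring} {u} {v})
                                vertical horizontal
      where
      vertical : ∀ i j → Separated colouring (i , j) (next i , j)
      vertical i j = let (≢ , _ , distinct , _) = compatible-at i j in ≢ , distinct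
      horizontal : ∀ i j → Separated colouring (i , j) (i , next j)
      horizontal i j = let (_ , ≢ , _ , distinct) = compatible-at i j in ≢ ,
        subst (λ j′ → ¬ SameColours (colours colouring (i , j))
                                    (localColours i (column j′) (column (next j)) (column (next (next j)))))
              (sym (prev-next j)) distinct

    stripes-lid : LidColourable (Torus m (3 + double (2 + k′))) k
    stripes-lid = colouring , separated⇒isLid colouring separated

double≡2* : ∀ k → double k ≡ 2 * k
double≡2* zero    = refl
double≡2* (suc k) = cong suc (trans (cong suc (double≡2* k)) (sym (+-suc k (k + 0))))

odd≥7-shape : Odd n → 7 ≤ n → ∃ λ k → n ≡ 3 + double (2 + k)
odd≥7-shape (0 , refl) (s≤s ())
odd≥7-shape (1 , refl) (s≤s (s≤s (s≤s ())))
odd≥7-shape (2 , refl) (s≤s (s≤s (s≤s (s≤s (s≤s ())))))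
odd≥7-shape (suc (suc (suc k)) , refl) _ =
  k , cong suc (trans (*-distribˡ-+ 2 3 k) (cong (6 +_) (sym (double≡2* k))))

χlid-torus : (T : Fin 5 → Fin m → Fin 4) → StripeColouring.Valid T → Odd m → 1 < m →
             Odd n → 7 ≤ n → χlid≡ (Torus m n) 4
χlid-torus T valid odd-m 1<m odd-n 7≤n with odd≥7-shape odd-n 7≤n
... | k , refl =
  StripeColouring.stripes-lid T valid k ,
  λ j j<4 → no-lid-3-colouring odd-m 1<m (s<s z<s) ∘ LidColourable-mono _ (s≤s⁻¹ j<4)

table : Vec (Vec (Fin k) m) 5 → Fin 5 → Fin m → Fin k
table rows r i = lookup (lookup rows r) i

T₇ : Fin 5 → Fin 7 → Fin 4
T₇ = table
  ( (# 2 ∷ # 3 ∷ # 2 ∷ # 1 ∷ # 2 ∷ # 0 ∷ # 3 ∷ [])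
  ∷ (# 3 ∷ # 0 ∷ # 3 ∷ # 2 ∷ # 1 ∷ # 2 ∷ # 1 ∷ [])
  ∷ (# 0 ∷ # 3 ∷ # 0 ∷ # 3 ∷ # 2 ∷ # 3 ∷ # 2 ∷ [])
  ∷ (# 2 ∷ # 1 ∷ # 3 ∷ # 0 ∷ # 1 ∷ # 0 ∷ # 1 ∷ [])
  ∷ (# 3 ∷ # 2 ∷ # 0 ∷ # 2 ∷ # 0 ∷ # 3 ∷ # 0 ∷ [])
  ∷ [])

T₇-valid : StripeColouring.Valid T₇
T₇-valid = toWitness {a? = StripeColouring.valid? T₇} _

T₉ : Fin 5 → Fin 9 → Fin 4
T₉ = table
  ( (# 0 ∷ # 2 ∷ # 0 ∷ # 2 ∷ # 3 ∷ # 1 ∷ # 3 ∷ # 2 ∷ # 3 ∷ [])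
  ∷ (# 3 ∷ # 1 ∷ # 2 ∷ # 0 ∷ # 2 ∷ # 3 ∷ # 2 ∷ # 3 ∷ # 1 ∷ [])
  ∷ (# 2 ∷ # 3 ∷ # 0 ∷ # 2 ∷ # 0 ∷ # 2 ∷ # 0 ∷ # 2 ∷ # 3 ∷ [])
  ∷ (# 0 ∷ # 2 ∷ # 3 ∷ # 1 ∷ # 2 ∷ # 1 ∷ # 2 ∷ # 1 ∷ # 2 ∷ [])
  ∷ (# 2 ∷ # 0 ∷ # 2 ∷ # 3 ∷ # 0 ∷ # 3 ∷ # 0 ∷ # 3 ∷ # 1 ∷ [])
  ∷ [])

T₉-valid : StripeColouring.Valid T₉
T₉-valid = toWitness {a? = StripeColouring.valid? T₉} _

T₁₁ : Fin 5 → Fin 11 → Fin 4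
T₁₁ = table
  ( (# 2 ∷ # 0 ∷ # 1 ∷ # 0 ∷ # 2 ∷ # 3 ∷ # 1 ∷ # 3 ∷ # 0 ∷ # 3 ∷ # 0 ∷ [])
  ∷ (# 0 ∷ # 3 ∷ # 0 ∷ # 2 ∷ # 0 ∷ # 1 ∷ # 3 ∷ # 2 ∷ # 3 ∷ # 1 ∷ # 3 ∷ [])
  ∷ (# 3 ∷ # 0 ∷ # 2 ∷ # 0 ∷ # 3 ∷ # 0 ∷ # 1 ∷ # 0 ∷ # 2 ∷ # 3 ∷ # 1 ∷ [])
  ∷ (# 2 ∷ # 3 ∷ # 1 ∷ # 2 ∷ # 1 ∷ # 2 ∷ # 0 ∷ # 2 ∷ # 0 ∷ # 1 ∷ # 3 ∷ [])
  ∷ (# 0 ∷ # 1 ∷ # 3 ∷ # 1 ∷ # 0 ∷ # 1 ∷ # 3 ∷ # 0 ∷ # 2 ∷ # 0 ∷ # 1 ∷ [])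
  ∷ [])

T₁₁-valid : StripeColouring.Valid T₁₁
T₁₁-valid = toWitness {a? = StripeColouring.valid? T₁₁} _

lemma13 : (m n : ℕ) → (m ≡ 7 ⊎ m ≡ 9 ⊎ m ≡ 11) → Odd n → m ≤ n →
    χlid≡ (Cycle m □ Cycle n) 4
lemma13 _ _ (inj₁ refl)        odd-n 7≤n  = χlid-torus T₇ T₇-valid (3 , refl) (s<s z<s) odd-n 7≤n
lemma13 _ _ (inj₂ (inj₁ refl)) odd-n 9≤n  = χlid-torus T₉ T₉-valid (4 , refl) (s<s z<s) odd-n (≤-trans (m≤n+m 7 2) 9≤n)
lemma13 _ _ (inj₂ (inj₂ refl)) odd-n 11≤n = χlid-torus T₁₁ T₁₁-valid (5 , refl) (s<s z<s) odd-n (≤-trans (m≤n+m 7 4) 11≤n)
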